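{- Let $G=(V,E)$ be a finite connected simple graph, and consider the two-player guessing game on $G$ in either the simultaneous or the alternating variant. There exists a correct strategy under which, for every placement, at least one of the two players eventually announces their position, if and only if $G$ is a tree.
   Context: The game: two players $A$ and $B$ are placed on the endpoints of an edge; a placement is an ordered pair $(a,b)$ with $\{a,b\}\in E$, meaning $A$ sits at $a$ and $B$ at $b$. Each player knows $G$ and the vertex of the other player, but not their own vertex. Time proceeds in discrete steps $t=1,2,\dots$. In the simultaneous variant, at each step each player either stays silent or announces a vertex (claiming it is their own position), both acting at the same time. In the alternating variant, $A$ may speak only at odd steps and $B$ only at even steps. All announcements are heard by both players. A strategy specifies for each player, as a function of $G$, the other player's vertex and the history of announcements so far, whether to stay silent or which vertex to announce at each step (the players may have agreed on it in advance). A strategy is correct if in every placement, whenever a player announces a vertex, it is that player's actual position. -}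

module Defs where

open import Data.Nat using (ℕ; zero; suc; _≤_)
open import Data.Fin using (Fin)
open import Data.Bool using (Bool; true; false; T; not)
open import Data.Maybe using (Maybe; just; nothing; Is-just)
open import Data.Product using (Σ; _×_; _,_; proj₁; proj₂; ∃)
open import Data.Sum using (_⊎_)
open import Data.List using (List; []; _∷_; _++_; [_]; length)
open import Data.List.Relation.Unary.Linked using (Linked)
open import Data.List.Relation.Unary.Unique.Propositional using (Unique)
open import Relation.Binary.PropositionalEquality using (_≡_)
open import Relation.Nullary using (¬_)

record Graph (n : ℕ) : Set where
  field
    adj    : Fin n → Fin n → Bool
    sym    : ∀ u v → adj u v ≡ adj v u
    irrefl : ∀ v → adj v v ≡ false

open Graph public

Adj : ∀ {n} → Graph n → Fin n → Fin n → Set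
Adj G u v = T (adj G u v)

data Walk {n : ℕ} (G : Graph n) : Fin n → Fin n → Set where
  here : ∀ {v} → Walk G v v
  step : ∀ {u v w} → Adj G u v → Walk G v w → Walk G u w

Connected : ∀ {n} → Graph n → Set
Connected G = ∀ u v → Walk G u v

-- a cycle v, v₁, …, v_k, v with k ≥ 2 (so at least 3 distinct vertices)
HasCycle : ∀ {n} → Graph n → Set
HasCycle {n} G =
  Σ (Fin n) λ v → Σ (List (Fin n)) λ vs →
    (2 ≤ length vs) × Unique (v ∷ vs) × Linked (Adj G) (v ∷ vs ++ [ v ])

IsTree : ∀ {n} → Graph n → Set
IsTree G = Connected G × ¬ HasCycle G

-- what happens at one time step: (A's announcement , B's announcement),
-- nothing = silent
Step : ℕ → Set
Step n = Maybe (Fin n) × Maybe (Fin n)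

-- history of announcements so far, most recent step first
History : ℕ → Set
History n = List (Step n)

-- a player's strategy: from the other player's vertex and the history,
-- decide to stay silent or announce a vertex
Strategy : ℕ → Set
Strategy n = Fin n → History n → Maybe (Fin n)

JointStrategy : ℕ → Set
JointStrategy n = Strategy n × Strategy n

data Variant : Set where
  simultaneous alternating : Variant

isOdd : ℕ → Bool
isOdd zero = false
isOdd (suc t) = not (isOdd t)

-- the moves at time step (suc t) (t = number of steps already played),
-- given placement (a , b) (A at a, B at b) and the history h.
move : ∀ {n} → Variant → JointStrategy n → Fin n → Fin n → ℕ → History n → Step n
move simultaneous (sA , sB) a b t h = sA b h , sB a h
move alternating  (sA , sB) a b t h with isOdd (suc t)
... | true  = sA b h , nothing
... | false = nothing , sB a h

history : ∀ {n} → Variant → JointStrategy n → Fin n → Fin n → ℕ → History n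
history var s a b zero    = []
history var s a b (suc t) = move var s a b t (history var s a b t) ∷ history var s a b t

announcements : ∀ {n} → Variant → JointStrategy n → Fin n → Fin n → ℕ → Step n
announcements var s a b t = move var s a b t (history var s a b t)

Correct : ∀ {n} → Graph n → Variant → JointStrategy n → Set
Correct {n} G var s = ∀ (a b : Fin n) → Adj G a b → ∀ t →
  (∀ v → proj₁ (announcements var s a b t) ≡ just v → v ≡ a) ×
  (∀ v → proj₂ (announcements var s a b t) ≡ just v → v ≡ b)

Terminates : ∀ {n} → Graph n → Variant → JointStrategy n → Set
Terminates {n} G var s = ∀ (a b : Fin n) → Adj G a b → ∃ λ t →
  Is-just (proj₁ (announcements var s a b t)) ⊎
  Is-just (proj₂ (announcements var s a b t))

module Submission where

-- A player cannot see its own vertex, so its announcements depend only on the vertex it sees and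
-- on the common history.  If every vertex of a set S has two distinct neighbours in S (the vertices
-- of a cycle form such a set), then on placements inside S a correct announcement would have to
-- name both neighbours of the seen vertex at once; by induction on time nobody ever speaks there.
--
-- On a tree, orient every edge towards a root, let dist be the distance to the root and
-- H = max dist ∸ dist.  A player seeing y claims the parent of y as its own vertex as soon as at
-- least 2·H y steps have passed, all of them silent.  Every edge joins a vertex to its parent, so
-- on each placement one player's claim is right and is eventually made; if a player's own parent
-- were the seen vertex y, the other player's earlier deadline 2·H(own) would already have broken
-- the silence.

open import Defs hiding (sym)
open import Data.Nat using (ℕ; zero; suc; _+_; _*_; _∸_; _≤_; _<_; s≤s; z≤n; _≤?_; _<?_)
open import Data.Nat.Properties
  using (+-suc; +-identityʳ; +-comm; ≤-refl; ≤-trans; n≤1+n; <-trans; <-irrefl; ≮⇒≥;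
         m<1+n⇒m<n∨m≡n; *-monoʳ-≤; *-suc; ∸-monoʳ-<)
open import Data.Nat.Induction using (<-wellFounded)
open import Induction.WellFounded using (Acc; acc)
open import Data.Fin as Fin using (Fin; _≟_)
open import Data.Fin.Properties using (any?)
open import Data.Bool using (Bool; true; false; T; not; _∧_; if_then_else_)
open import Data.Bool.Properties using (T?; T-∧)
open import Data.Maybe using (Maybe; just; nothing; Is-just)
open import Data.Maybe.Relation.Unary.Any using (just)
import Data.Maybe.Properties as Maybe
open import Data.Product using (Σ; ∃; ∃₂; _×_; _,_; -,_; proj₁; proj₂)
open import Data.Sum using (_⊎_; inj₁; inj₂; [_,_]′)
open import Data.Empty using (⊥; ⊥-elim)
open import Data.List
  using (List; []; _∷_; _++_; [_]; _∷ʳ_; length; replicate; map; allFin; initLast; _∷ʳ′_)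
open import Data.List.Properties using (++-assoc; length-++)
open import Data.List.Extrema.Nat using (max; xs≤max)
open import Data.List.Relation.Unary.Linked as Linked using (Linked; [-]; _∷_)
open import Data.List.Relation.Unary.Linked.Properties using (Linked⇒AllPairs)
open import Data.List.Relation.Unary.All as All using (All; [])
open import Data.List.Relation.Unary.All.Properties using (¬Any⇒All¬)
open import Data.List.Relation.Unary.Any as Any using (Any; here; there)
import Data.List.Relation.Unary.AllPairs as AllPairs
open import Data.List.Relation.Unary.Unique.Propositional using (Unique; []; _∷_)
import Data.List.Relation.Unary.Unique.Propositional.Properties as Unique
open import Data.List.Membership.Propositional using (_∈_)
open import Data.List.Membership.Propositional.Properties using (∈-++⁺ˡ; ∈-++⁺ʳ; ∈-map⁺; ∈-allFin)
open import Level using (_⊔_)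
open import Relation.Binary.Core using (Rel; _⇒_)
open import Relation.Binary.Definitions using (Transitive; Irreflexive)
open import Relation.Binary.PropositionalEquality
  using (_≡_; _≢_; refl; sym; trans; cong; cong₂; subst; module ≡-Reasoning)
open import Relation.Nullary using (¬_; Dec; yes; no; contradiction)
open import Relation.Nullary.Decidable using (_×-dec_; _⊎-dec_; decidable-stable)
open import Relation.Unary using (Pred; Decidable; ∁)
open import Function using (flip; _∘_)
open import Function.Bundles using (_⇔_; mk⇔; Equivalence)

module _ {a ℓ} {A : Set a} {R : Rel A ℓ} where

  linked-∷ʳ⁺ : ∀ xs {x y} → Linked R (xs ∷ʳ x) → R x y → Linked R (xs ∷ʳ x ∷ʳ y)
  linked-∷ʳ⁺ []           [-]       r = r ∷ [-]
  linked-∷ʳ⁺ (_ ∷ [])     (s ∷ [-]) r = s ∷ r ∷ [-]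
  linked-∷ʳ⁺ (_ ∷ z ∷ zs) (s ∷ l)   r = s ∷ linked-∷ʳ⁺ (z ∷ zs) l r

  linked-∷ʳ⁻ : ∀ xs {x y} → Linked R (xs ∷ʳ x ∷ʳ y) → R x y
  linked-∷ʳ⁻ []       l = Linked.head l
  linked-∷ʳ⁻ (_ ∷ xs) l = linked-∷ʳ⁻ xs (Linked.tail l)

  linked⇒unique : Transitive R → Irreflexive _≡_ R → ∀ {xs} → Linked R xs → Unique xs
  linked⇒unique trans irrefl l = AllPairs.map (λ r eq → irrefl eq r) (Linked⇒AllPairs trans l)

data Chain {a ℓ} {A : Set a} (R : Rel A ℓ) : A → List A → A → Set (a ⊔ ℓ) where
  []  : ∀ {x} → Chain R x [] x
  _∷_ : ∀ {x y ys z} → R x y → Chain R y ys z → Chain R x (y ∷ ys) z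

module _ {a ℓ} {A : Set a} {R : Rel A ℓ} where

  infixl 5 _∷ʳᶜ_
  _∷ʳᶜ_ : ∀ {x xs y z} → Chain R x xs y → R y z → Chain R x (xs ∷ʳ z) z
  []      ∷ʳᶜ r = r ∷ []
  (s ∷ c) ∷ʳᶜ r = s ∷ (c ∷ʳᶜ r)

  infixr 5 _++ᶜ_
  _++ᶜ_ : ∀ {x xs y ys z} → Chain R x xs y → Chain R y ys z → Chain R x (xs ++ ys) z
  []      ++ᶜ d = d
  (r ∷ c) ++ᶜ d = r ∷ (c ++ᶜ d)

  chain⇒linked : ∀ {x xs z} → Chain R x xs z → Linked R (x ∷ xs)
  chain⇒linked []          = [-]
  chain⇒linked (r ∷ [])    = r ∷ [-]
  chain⇒linked (r ∷ s ∷ c) = r ∷ chain⇒linked (s ∷ c)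

  chain-end∈ : ∀ {x xs z} → Chain R x xs z → z ∈ x ∷ xs
  chain-end∈ []      = here refl
  chain-end∈ (_ ∷ c) = there (chain-end∈ c)

  chain-split : ∀ {x xs z m} → Chain R x xs z → m ∈ x ∷ xs →
                ∃₂ λ ys zs → xs ≡ ys ++ zs × Chain R x ys m × Chain R m zs z
  chain-split c       (here refl) = [] , _ , refl , [] , c
  chain-split (r ∷ c) (there m∈)  with ys , zs , refl , c₁ , c₂ ← chain-split c m∈ =
    _ ∷ ys , zs , refl , r ∷ c₁ , c₂

  chain-last-hit : ∀ {p} {P : Pred A p} → Decidable P → ∀ {x xs z} → Chain R x xs z →
                   Any P (x ∷ xs) → ∃₂ λ m ys → P m × Chain R m ys z × All (∁ P) ys
  chain-last-hit P? [] (here px) = -, -, px , [] , []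
  chain-last-hit P? {xs = _ ∷ ys} (r ∷ c) hit with Any.any? P? (_ ∷ ys)
  ... | yes later = chain-last-hit P? c later
  ... | no  none  with hit
  ...   | here px     = -, -, px , r ∷ c , ¬Any⇒All¬ _ none
  ...   | there later = contradiction later none

chain-reverse : ∀ {a ℓ} {A : Set a} {R : Rel A ℓ} {x xs z} → Chain R x xs z →
                ∃ λ ys → Chain (flip R) z ys x
chain-reverse []      = [] , []
chain-reverse (r ∷ c) with ys , d ← chain-reverse c = -, d ∷ʳᶜ r

chain-map : ∀ {a ℓ ℓ′} {A : Set a} {R : Rel A ℓ} {S : Rel A ℓ′} → R ⇒ S →
            ∀ {x xs z} → Chain R x xs z → Chain S x xs z
chain-map f []      = []
chain-map f (r ∷ c) = f r ∷ chain-map f c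

least : ∀ {p} {P : Pred ℕ p} → Decidable P → ∀ {k} → P k →
        ∃ λ m → P m × (∀ {j} → j < m → ¬ P j)
least {P = P} P? {k} pk = search 0 k (λ ()) (subst P (sym (+-identityʳ k)) pk)
  where
  search : ∀ i k → (∀ {j} → j < i → ¬ P j) → P (k + i) → ∃ λ m → P m × (∀ {j} → j < m → ¬ P j)
  search i k below p with P? i
  ... | yes pi = i , pi , below
  search i zero    below p | no ¬pi = contradiction p ¬pi
  search i (suc k) below p | no ¬pi = search (suc i) k below′ (subst P (sym (+-suc k i)) p)
    where
    below′ : ∀ {j} → j < suc i → ¬ P j
    below′ j<1+i = [ below , (λ { refl → ¬pi }) ]′ (m<1+n⇒m<n∨m≡n j<1+i)

data Player : Set where
  A B : Player

other : Player → Player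
other A = B
other B = A

module _ {n : ℕ} where

  -- own is defined through other, so that the vertex seen by the other player is definitionally
  -- one's own vertex.
  seen own : Player → Fin n → Fin n → Fin n
  seen A a b = b
  seen B a b = a
  own p = seen (other p)

  utterance : Player → Step n → Maybe (Fin n)
  utterance A = proj₁
  utterance B = proj₂

  strategyOf : Player → JointStrategy n → Strategy n
  strategyOf A = proj₁
  strategyOf B = proj₂

  Speaks : Step n → Set
  Speaks x = Is-just (proj₁ x) ⊎ Is-just (proj₂ x)

  silence : ℕ → History n
  silence t = replicate t (nothing , nothing)

  silence-speaks-not : ∀ {x : Step n} → x ≡ (nothing , nothing) → ¬ Speaks x
  silence-speaks-not refl (inj₁ ())
  silence-speaks-not refl (inj₂ ())

  utterance-of-silence : ∀ p {x : Step n} → x ≡ (nothing , nothing) → utterance p x ≡ nothing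
  utterance-of-silence A refl = refl
  utterance-of-silence B refl = refl

  utterance⇒speaks : ∀ p {x : Step n} → Is-just (utterance p x) → Speaks x
  utterance⇒speaks A = inj₁
  utterance⇒speaks B = inj₂

turn : Variant → Player → ℕ → Bool
turn simultaneous _ _ = true
turn alternating  A t = isOdd (suc t)
turn alternating  B t = not (isOdd (suc t))

turn-within-two : ∀ var p t → T (turn var p t) ⊎ T (turn var p (suc t))
turn-within-two simultaneous p t = inj₁ _
turn-within-two alternating  A t with isOdd (suc t)
... | true  = inj₁ _
... | false = inj₂ _
turn-within-two alternating  B t with isOdd (suc t)
... | true  = inj₂ _
... | false = inj₁ _

utterance-move : ∀ {n} var p (s : JointStrategy n) a b t h →
  utterance p (move var s a b t h) ≡ (if turn var p t then strategyOf p s (seen p a b) h else nothing)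
utterance-move simultaneous A s a b t h = refl
utterance-move simultaneous B s a b t h = refl
utterance-move alternating  A s a b t h with isOdd (suc t)
... | true  = refl
... | false = refl
utterance-move alternating  B s a b t h with isOdd (suc t)
... | true  = refl
... | false = refl

length-history : ∀ {n} var (s : JointStrategy n) a b t → length (history var s a b t) ≡ t
length-history var s a b zero    = refl
length-history var s a b (suc t) = cong suc (length-history var s a b t)

module _ {n : ℕ} (G : Graph n) where

  Adj-sym : ∀ {u v} → Adj G u v → Adj G v u
  Adj-sym {u} {v} = subst T (Graph.sym G u v)

  seat-adj : ∀ p {a b} → Adj G a b → Adj G (own p a b) (seen p a b)
  seat-adj A ab = ab
  seat-adj B ab = Adj-sym ab

-- Cycles

module _ {n : ℕ} (G : Graph n) where

  IsCycle : Fin n → List (Fin n) → Set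
  IsCycle v vs = 2 ≤ length vs × Unique (v ∷ vs) × Linked (Adj G) (v ∷ vs ++ [ v ])

  OnCycle : Fin n → Set
  OnCycle v = Σ (List (Fin n)) (IsCycle v)

  rotate : ∀ {v y zs} → IsCycle v (y ∷ zs) → IsCycle y (zs ∷ʳ v)
  rotate {v} {y} {zs} (2≤ , v∉ ∷ u , vy ∷ l) =
    subst (2 ≤_) (sym (trans (length-++ zs) (+-comm (length zs) 1))) 2≤ ,
    Unique.++⁺ u ([] ∷ []) (λ { (x∈ , here refl) → All.lookup v∉ x∈ refl }) ,
    linked-∷ʳ⁺ (y ∷ zs) l vy

  rotate-to : ∀ {v b} pre {post} → IsCycle v (pre ++ b ∷ post) → OnCycle b
  rotate-to []        {post} c = post ∷ʳ _ , rotate c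
  rotate-to (y ∷ pre) {post} c =
    rotate-to pre (subst (IsCycle y) (++-assoc pre (_ ∷ post) [ _ ]) (rotate c))

  TwoNeighbours : (Fin n → Set) → Fin n → Set
  TwoNeighbours S v = ∃₂ λ p q → p ≢ q × (S p × Adj G p v) × (S q × Adj G q v)

  cycle-neighbours : ∀ v → OnCycle v → TwoNeighbours OnCycle v
  cycle-neighbours v (vs , c) with initLast vs
  cycle-neighbours v (_ , () , _)     | []
  cycle-neighbours v (_ , s≤s () , _) | [] ∷ʳ′ q
  cycle-neighbours v (_ , c@(_ , _ ∷ (y∉ ∷ _) , l)) | (y ∷ ws) ∷ʳ′ q =
    y , q , (λ y≡q → All.lookup y∉ (∈-++⁺ʳ ws (here refl)) y≡q) ,
    (rotate-to [] c , Adj-sym G (Linked.head l)) ,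
    (rotate-to (y ∷ ws) c , linked-∷ʳ⁻ (v ∷ y ∷ ws) l)

never-just : ∀ {X : Set} {x : Maybe X} → (∀ v → x ≡ just v → ⊥) → x ≡ nothing
never-just {x = nothing} _ = refl
never-just {x = just v}  f = ⊥-elim (f v refl)

module Silence {n} (G : Graph n) (var : Variant) (s : JointStrategy n) (correct : Correct G var s)
               (S : Fin n → Set) (two-neighbours : ∀ v → S v → TwoNeighbours G S v) where

  Inside : Fin n → Fin n → Set
  Inside a b = S a × S b × Adj G a b

  view-determines-utterance :
    ∀ p {a b a′ b′} t → seen p a b ≡ seen p a′ b′ → history var s a b t ≡ history var s a′ b′ t →
    utterance p (announcements var s a b t) ≡ utterance p (announcements var s a′ b′ t)
  view-determines-utterance p {a} {b} {a′} {b′} t same-view same-past = begin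
    utterance p (announcements var s a b t)
      ≡⟨ utterance-move var p s a b t _ ⟩
    (if turn var p t then strategyOf p s (seen p a b) (history var s a b t) else nothing)
      ≡⟨ cong₂ (λ y h → if turn var p t then strategyOf p s y h else nothing) same-view same-past ⟩
    (if turn var p t then strategyOf p s (seen p a′ b′) (history var s a′ b′ t) else nothing)
      ≡⟨ utterance-move var p s a′ b′ t _ ⟨
    utterance p (announcements var s a′ b′ t) ∎
    where open ≡-Reasoning

  silent-step : ∀ t → (∀ {a b} → Inside a b → history var s a b t ≡ silence t) →
                ∀ {a b} → Inside a b → announcements var s a b t ≡ (nothing , nothing)
  silent-step t quiet {a} {b} ab∈@(Sa , Sb , ab) = cong₂ _,_ (never-just A-mute) (never-just B-mute)
    where
    A-mute : ∀ v → proj₁ (announcements var s a b t) ≡ just v → ⊥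
    A-mute v says with p , q , p≢q , (Sp , pb) , (Sq , qb) ← two-neighbours b Sb =
      p≢q (trans (sym (heard Sp pb)) (heard Sq qb))
      where
      heard : ∀ {x} → S x → Adj G x b → v ≡ x
      heard {x} Sx xb = proj₁ (correct x b xb t) v
        (trans (view-determines-utterance A t refl (trans (quiet (Sx , Sb , xb)) (sym (quiet ab∈)))) says)
    B-mute : ∀ v → proj₂ (announcements var s a b t) ≡ just v → ⊥
    B-mute v says with p , q , p≢q , (Sp , pa) , (Sq , qa) ← two-neighbours a Sa =
      p≢q (trans (sym (heard Sp pa)) (heard Sq qa))
      where
      heard : ∀ {x} → S x → Adj G x a → v ≡ x
      heard {x} Sx xa = proj₂ (correct a x (Adj-sym G xa) t) v
        (trans (view-determines-utterance B t refl (trans (quiet (Sa , Sx , Adj-sym G xa)) (sym (quiet ab∈)))) says)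

  silent-inside : ∀ t {a b} → Inside a b → history var s a b t ≡ silence t
  silent-inside zero    _   = refl
  silent-inside (suc t) ab∈ = cong₂ _∷_ (silent-step t (silent-inside t) ab∈) (silent-inside t ab∈)

cycle-blocks-termination : ∀ {n} (G : Graph n) var s → Correct G var s → HasCycle G → ¬ Terminates G var s
cycle-blocks-termination G var s correct (v , on-cycle) terminates
  with p , _ , _ , (p-on , pv) , _ ← cycle-neighbours G v on-cycle
  with t , speaks ← terminates p v pv
  = silence-speaks-not (silent-step t (silent-inside t) (p-on , on-cycle , pv)) speaks
  where open Silence G var s correct (OnCycle G) (cycle-neighbours G)

-- A strategy from an orientation of the edges

if-just : ∀ {X : Set} {c : Bool} {x : Maybe X} {v} → (if c then x else nothing) ≡ just v → T c × x ≡ just v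
if-just {c = true} eq = _ , eq

if-true : ∀ {X : Set} {c : Bool} {x y : X} → T c → (if c then x else y) ≡ x
if-true {c = true} _ = refl

module OrientedStrategy {n} (G : Graph n) (par : Fin n → Maybe (Fin n)) (H : Fin n → ℕ)
    (orient : ∀ {u w} → Adj G u w → par u ≡ just w ⊎ par w ≡ just u)
    (climb : ∀ {x y} → par x ≡ just y → H x < H y) where

  silent : Step n → Bool
  silent (nothing , nothing) = true
  silent _                   = false

  silent-or-speaks : ∀ x → T (silent x) ⊎ Speaks x
  silent-or-speaks (nothing , nothing) = inj₁ _
  silent-or-speaks (just _  , _)       = inj₂ (inj₁ (just _))
  silent-or-speaks (nothing , just _)  = inj₂ (inj₂ (just _))

  silent-sound : ∀ x → T (silent x) → x ≡ (nothing , nothing)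
  silent-sound (nothing , nothing) _ = refl

  quiet : History n → Bool
  quiet []      = true
  quiet (x ∷ h) = silent x ∧ quiet h

  -- The deadline is doubled so that, also in the alternating variant, each player gets a turn
  -- within every two consecutive steps.
  respond : Strategy n
  respond y h with quiet h | 2 * H y ≤? length h
  ... | true | yes _ = par y
  ... | _    | _     = nothing

  respond-just : ∀ y h {v} → respond y h ≡ just v → par y ≡ just v × T (quiet h) × 2 * H y ≤ length h
  respond-just y h eq with quiet h | 2 * H y ≤? length h
  ... | true | yes due = eq , _ , due

  respond-due : ∀ y h → T (quiet h) → 2 * H y ≤ length h → respond y h ≡ par y
  respond-due y h q due with quiet h | 2 * H y ≤? length h
  ... | true | yes _    = refl
  ... | true | no undue = contradiction due undue

  joint : JointStrategy n
  joint = respond , respond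

  module Play (var : Variant) (a b : Fin n) where

    past : ℕ → History n
    past = history var joint a b

    now : ℕ → Step n
    now = announcements var joint a b

    said-by : ∀ p t → utterance p (now t) ≡ (if turn var p t then respond (seen p a b) (past t) else nothing)
    said-by A t = utterance-move var A joint a b t (past t)
    said-by B t = utterance-move var B joint a b t (past t)

    quiet-before : ∀ {t t′} → t′ < t → T (quiet (past t)) → T (quiet (past t′)) × now t′ ≡ (nothing , nothing)
    quiet-before {suc t} t′<1+t q with Equivalence.to T-∧ q | m<1+n⇒m<n∨m≡n t′<1+t
    ... | _ , q′ | inj₁ t′<t = quiet-before t′<t q′
    ... | s , q′ | inj₂ refl = q′ , silent-sound (now t) s

    quiet-or-speaks : ∀ t → T (quiet (past t)) ⊎ ∃ λ t′ → Speaks (now t′)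
    quiet-or-speaks zero    = inj₁ _
    quiet-or-speaks (suc t) with quiet-or-speaks t | silent-or-speaks (now t)
    ... | inj₂ spoke | _      = inj₂ spoke
    ... | inj₁ q     | inj₁ s = inj₁ (Equivalence.from T-∧ (s , q))
    ... | inj₁ _     | inj₂ x = inj₂ (t , x)

    turn-after : ∀ p m → ∃ λ t → m ≤ t × t ≤ suc m × T (turn var p t)
    turn-after p m with turn-within-two var p m
    ... | inj₁ this = m , ≤-refl , n≤1+n m , this
    ... | inj₂ next = suc m , n≤1+n m , ≤-refl , next

    speaks-when-due : ∀ p {t} → T (turn var p t) → T (quiet (past t)) → 2 * H (seen p a b) ≤ t →
                      utterance p (now t) ≡ par (seen p a b)
    speaks-when-due p {t} my-turn q due = begin
      utterance p (now t)                                                      ≡⟨ said-by p t ⟩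
      (if turn var p t then respond (seen p a b) (past t) else nothing)       ≡⟨ if-true my-turn ⟩
      respond (seen p a b) (past t)                                            ≡⟨ respond-due (seen p a b) (past t) q due′ ⟩
      par (seen p a b)                                                         ∎
      where
      open ≡-Reasoning
      due′ : 2 * H (seen p a b) ≤ length (past t)
      due′ = subst (2 * H (seen p a b) ≤_) (sym (length-history var joint a b t)) due

    overdue : ∀ q {t z} → par (seen q a b) ≡ just z → 2 + 2 * H (seen q a b) ≤ t → ¬ T (quiet (past t))
    overdue q {t} par-seen late quiet-t
      with t′ , due , t′≤ , my-turn ← turn-after q (2 * H (seen q a b))
      with quiet-t′ , silent-t′ ← quiet-before (≤-trans (s≤s t′≤) late) quiet-t
      with () ← trans (sym (utterance-of-silence q silent-t′))
                      (trans (speaks-when-due q my-turn quiet-t′ due) par-seen)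

    honest : ∀ p {t v} → Adj G a b → utterance p (now t) ≡ just v → v ≡ own p a b
    honest p {t} ab said
      with _ , responded ← if-just (trans (sym (said-by p t)) said)
      with par-seen , quiet-t , due ← respond-just (seen p a b) (past t) responded
      with orient (seat-adj G p ab)
    ... | inj₂ par-seen′ = Maybe.just-injective (trans (sym par-seen) par-seen′)
    ... | inj₁ par-own   = ⊥-elim (overdue (other p) par-own late quiet-t)
      where
      late : 2 + 2 * H (own p a b) ≤ t
      late = ≤-trans (subst (_≤ 2 * H (seen p a b)) (*-suc 2 (H (own p a b))) (*-monoʳ-≤ 2 (climb par-own)))
                     (subst (2 * H (seen p a b) ≤_) (length-history var joint a b t) due)

    eventually : ∀ p {z} → par (seen p a b) ≡ just z → ∃ λ t → Speaks (now t)
    eventually p par-seen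
      with t , due , _ , my-turn ← turn-after p (2 * H (seen p a b))
      with quiet-or-speaks t
    ... | inj₂ spoke   = spoke
    ... | inj₁ quiet-t = t , utterance⇒speaks p
      (subst Is-just (sym (trans (speaks-when-due p my-turn quiet-t due) par-seen)) (just _))

  correct : ∀ var → Correct G var joint
  correct var a b ab t = (λ _ → honest A ab) , (λ _ → honest B ab)
    where open Play var a b

  terminates : ∀ var → Terminates G var joint
  terminates var a b ab = [ eventually B , eventually A ]′ (orient ab)
    where open Play var a b

-- Orienting a tree towards a root

module Distance {n} (G : Graph n) (connected : Connected G) (root : Fin n) where

  Reach : ℕ → Fin n → Set
  Reach zero    v = v ≡ root
  Reach (suc k) v = Reach k v ⊎ ∃ λ u → Reach k u × Adj G u v

  reach? : ∀ k v → Dec (Reach k v)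
  reach? zero    v = v ≟ root
  reach? (suc k) v = reach? k v ⊎-dec any? (λ u → reach? k u ×-dec T? (adj G u v))

  reach-along : ∀ {k u v} → Reach k u → Walk G u v → ∃ λ j → Reach j v
  reach-along r here       = -, r
  reach-along r (step a w) = reach-along (inj₂ (-, r , a)) w

  shortest : ∀ v → ∃ λ k → Reach k v × (∀ {j} → j < k → ¬ Reach j v)
  shortest v = least (λ k → reach? k v) (proj₂ (reach-along refl (connected root v)))

  dist : Fin n → ℕ
  dist v = proj₁ (shortest v)

  dist-≤ : ∀ {k v} → Reach k v → dist v ≤ k
  dist-≤ {k} {v} r = ≮⇒≥ (λ k<d → proj₂ (proj₂ (shortest v)) k<d r)

  descent : ∀ v → v ≢ root → ∃ λ u → Adj G u v × dist u < dist v
  descent v = step-back (proj₁ (proj₂ (shortest v))) (proj₂ (proj₂ (shortest v)))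
    where
    step-back : ∀ {k} → Reach k v → (∀ {j} → j < k → ¬ Reach j v) → v ≢ root →
                ∃ λ u → Adj G u v × dist u < k
    step-back {zero}  v≡root             _       v≢root = contradiction v≡root v≢root
    step-back {suc k} (inj₁ r)           minimal _      = contradiction r (minimal ≤-refl)
    step-back {suc k} (inj₂ (u , r , a)) _       _      = u , a , s≤s (dist-≤ r)

module Rooted {n} (G : Graph n) (root : Fin n) (ρ : Fin n → ℕ)
              (descent : ∀ v → v ≢ root → ∃ λ u → Adj G u v × ρ u < ρ v) where

  open import Data.List.Membership.DecPropositional {A = Fin n} _≟_ using (_∈?_)

  Closer : Fin n → Fin n → Set
  Closer v u = Adj G u v × ρ u < ρ v

  closer? : ∀ v → Dec (∃ (Closer v))
  closer? v = any? (λ u → T? (adj G u v) ×-dec ρ u <? ρ v)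

  parent : Fin n → Maybe (Fin n)
  parent v with closer? v
  ... | yes (u , _) = just u
  ... | no  _       = nothing

  Parent : Fin n → Fin n → Set
  Parent v u = parent v ≡ just u

  parent-closer : ∀ {v u} → Parent v u → Closer v u
  parent-closer {v} eq with closer? v
  parent-closer refl | yes (_ , c) = c

  parentless-root : ∀ v → parent v ≡ nothing → v ≡ root
  parentless-root v eq with closer? v
  ... | no none = decidable-stable (v ≟ root) (λ v≢root → none (descent v v≢root))

  ancestry : ∀ v → Acc _<_ (ρ v) → ∃ λ vs → Chain Parent v vs root
  ancestry v (acc smaller) with parent v in eq
  ... | just u  with us , c ← ancestry u (smaller (proj₂ (parent-closer eq))) = u ∷ us , eq ∷ c
  ... | nothing with refl   ← parentless-root v eq = [] , []

  ascent-unique : ∀ {v vs u} → Chain Parent v vs u → Unique (v ∷ vs)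
  ascent-unique c = linked⇒unique (λ p q → <-trans q p) (λ { refl → <-irrefl refl })
    (Linked.map (proj₂ ∘ parent-closer) (chain⇒linked c))

  descent-unique : ∀ {v vs u} → Chain (flip Parent) v vs u → Unique (v ∷ vs)
  descent-unique c = linked⇒unique <-trans (λ { refl → <-irrefl refl })
    (Linked.map (proj₂ ∘ parent-closer) (chain⇒linked c))

  detour-length : ∀ {w ws m vs u} → Chain Parent w ws m → Chain (flip Parent) m vs u →
                  u ≢ w → ¬ Parent u w → ¬ Parent w u → 2 ≤ length (ws ++ vs)
  detour-length []          []          u≢w _   _   = contradiction refl u≢w
  detour-length []          (p ∷ [])    _   ¬uw _   = contradiction p ¬uw
  detour-length []          (_ ∷ _ ∷ _) _   _   _   = s≤s (s≤s z≤n)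
  detour-length (p ∷ [])    []          _   _   ¬wu = contradiction p ¬wu
  detour-length (_ ∷ [])    (_ ∷ _)     _   _   _   = s≤s (s≤s z≤n)
  detour-length (_ ∷ _ ∷ _) _           _   _   _   = s≤s (s≤s z≤n)

  -- The cycle climbs from w along its ancestry to the last vertex m of the path from the root
  -- down to u that lies on this ancestry, descends from m to u and returns to w over the edge.
  non-parent-edge-cycle : ∀ {u w} → Adj G u w → ¬ Parent u w → ¬ Parent w u → HasCycle G
  non-parent-edge-cycle {u} {w} uw ¬uw ¬wu
    with ws , up ← ancestry w (<-wellFounded (ρ w))
    with _ , down ← chain-reverse (proj₂ (ancestry u (<-wellFounded (ρ u))))
    with m , vs , m∈up , m↓u , vs∉up ← chain-last-hit (_∈? w ∷ ws) down (here (chain-end∈ up))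
    with ws′ , _ , refl , w↑m , _ ← chain-split up m∈up
    = w , ws′ ++ vs ,
      detour-length w↑m m↓u (λ { refl → subst T (irrefl G u) uw }) ¬uw ¬wu ,
      Unique.++⁺ (ascent-unique w↑m) (AllPairs.tail (descent-unique m↓u))
        (λ (x∈ws′ , x∈vs) → All.lookup vs∉up x∈vs (∈-++⁺ˡ x∈ws′)) ,
      chain⇒linked ((chain-map (Adj-sym G ∘ proj₁ ∘ parent-closer) w↑m
                      ++ᶜ chain-map (proj₁ ∘ parent-closer) m↓u) ∷ʳᶜ uw)

  parent-edge : ¬ HasCycle G → ∀ {u w} → Adj G u w → Parent u w ⊎ Parent w u
  parent-edge acyclic {u} {w} uw
    with Maybe.≡-dec _≟_ (parent u) (just w) | Maybe.≡-dec _≟_ (parent w) (just u)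
  ... | yes uw-parent | _             = inj₁ uw-parent
  ... | no _          | yes wu-parent = inj₂ wu-parent
  ... | no ¬uw        | no ¬wu        = contradiction (non-parent-edge-cycle uw ¬uw ¬wu) acyclic

tree-strategy : ∀ {n} (G : Graph n) → Connected G → IsTree G → ∀ var →
                Σ (JointStrategy n) λ s → Correct G var s × Terminates G var s
tree-strategy {zero}  G _         _             var = ((λ ()) , (λ ())) , (λ ()) , (λ ())
tree-strategy {suc _} G connected (_ , acyclic) var = joint , correct var , terminates var
  where
  open Distance G connected Fin.zero
  open Rooted G Fin.zero dist descent

  H : Fin _ → ℕ
  H v = max 0 (map dist (allFin _)) ∸ dist v

  climb : ∀ {x y} → parent x ≡ just y → H x < H y
  climb {x} eq = ∸-monoʳ-< (proj₂ (parent-closer eq)) (All.lookup (xs≤max 0 _) (∈-map⁺ dist (∈-allFin x)))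

  open OrientedStrategy G parent H (parent-edge acyclic) climb

theorem2p2 : ∀ {n : ℕ} (G : Graph n) → Connected G → (var : Variant) →
    (Σ (JointStrategy n) λ s → Correct G var s × Terminates G var s) ⇔ IsTree G
theorem2p2 G connected var = mk⇔
  (λ (s , correct , terminates) →
     connected , λ cycle → cycle-blocks-termination G var s correct cycle terminates)
  (λ tree → tree-strategy G connected tree var)
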